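{- For a morphism of residuated lattices $f:A\to B$ let $\overline f:A/Ds(A)\to B/Ds(B)$, $\overline f(a/Ds(A))=f(a)/Ds(B)$. Then: if $f$ is surjective, $\overline f$ is surjective; if $f$ is injective, $\overline f$ is injective; and for any family $\{A_i\}_{i\in I}$ of residuated lattices, $A=\prod_{i\in I}A_i$ satisfies $Ds(A)=\prod_{i\in I}Ds(A_i)$ and $A/Ds(A)=\prod_{i\in I}A_i/Ds(A_i)$ (the map $(a_i)_i/Ds(A)\mapsto(a_i/Ds(A_i))_i$ being an isomorphism, with the quotient map of $A$ equal to the product of the quotient maps of the $A_i$). That is, the functor $T(A)=A/Ds(A)$, $T(f)=\overline f$ preserves surjective morphisms, injective morphisms and direct products.
   Context: A residuated lattice is a commutative integral residuated bounded lattice $(A,\vee,\wedge,\odot,\rightarrow,0,1)$ (bounded lattice, commutative monoid $(A,\odot,1)$, $a\le b\rightarrow c$ iff $a\odot b\le c$); $\neg a:=a\rightarrow0$; morphisms preserve all operations. $Ds(A)=\{a\in A\mid \neg a=0\}$ is a filter (nonempty, closed under $\odot$, upward closed). For a filter $F$, $A/F$ is the quotient by the congruence $a\equiv b$ iff $(a\rightarrow b)\wedge(b\rightarrow a)\in F$, with classes $a/F$; $\overline f$ is a well-defined morphism. -}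

module Defs where

open import Level using (Level; _⊔_) renaming (suc to lsuc)
open import Data.Product using (Σ; _×_; _,_; proj₁; proj₂; ∃)
open import Function.Bundles using (_⇔_; mk⇔; Equivalence)
open import Relation.Binary.Core using (Rel)
open import Relation.Binary.Structures using (IsPartialOrder; IsPreorder; IsEquivalence)
open import Relation.Binary.Lattice.Structures using (IsBoundedLattice; IsLattice)
open import Algebra.Core using (Op₂)
open import Algebra.Structures using (IsCommutativeMonoid; IsMonoid; IsSemigroup; IsMagma)

record ResiduatedLattice (c ℓ₁ ℓ₂ : Level) : Set (lsuc (c ⊔ ℓ₁ ⊔ ℓ₂)) where
  infixr 5 _⇒_
  infixl 7 _⊙_
  infixl 6 _∧_
  infixl 6 _∨_
  infix 4 _≈_ _≤_
  field
    Carrier : Set c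
    _≈_     : Rel Carrier ℓ₁
    _≤_     : Rel Carrier ℓ₂
    _∨_     : Op₂ Carrier
    _∧_     : Op₂ Carrier
    _⊙_     : Op₂ Carrier
    _⇒_     : Op₂ Carrier
    0#      : Carrier
    1#      : Carrier
    isBoundedLattice      : IsBoundedLattice _≈_ _≤_ _∨_ _∧_ 1# 0#
    ⊙-isCommutativeMonoid : IsCommutativeMonoid _≈_ _⊙_ 1#
    residuated            : ∀ a b d → (a ≤ (b ⇒ d)) ⇔ ((a ⊙ b) ≤ d)

  ¬_ : Carrier → Carrier
  ¬ a = a ⇒ 0#

  Ds : Carrier → Set ℓ₁
  Ds a = (¬ a) ≈ 0#

  -- the congruence of A/F for the filter F = Ds(A):
  -- a ~ b  iff  (a → b) ∧ (b → a) ∈ Ds(A).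
  -- (Elements of A/Ds(A) are represented by elements of A, with this relation
  --  as equality; a / Ds(A) is represented by a.)
  _∼Ds_ : Rel Carrier ℓ₁
  a ∼Ds b = Ds ((a ⇒ b) ∧ (b ⇒ a))

open ResiduatedLattice

record IsMorphism {c₁ ℓ₁ ℓ₂ c₂ ℓ₃ ℓ₄ : Level}
                  (A : ResiduatedLattice c₁ ℓ₁ ℓ₂) (B : ResiduatedLattice c₂ ℓ₃ ℓ₄)
                  (f : Carrier A → Carrier B) : Set (c₁ ⊔ ℓ₁ ⊔ ℓ₃) where
  field
    cong   : ∀ {x y} → _≈_ A x y → _≈_ B (f x) (f y)
    pres-∨ : ∀ x y → _≈_ B (f (_∨_ A x y)) (_∨_ B (f x) (f y))
    pres-∧ : ∀ x y → _≈_ B (f (_∧_ A x y)) (_∧_ B (f x) (f y))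
    pres-⊙ : ∀ x y → _≈_ B (f (_⊙_ A x y)) (_⊙_ B (f x) (f y))
    pres-⇒ : ∀ x y → _≈_ B (f (_⇒_ A x y)) (_⇒_ B (f x) (f y))
    pres-0 : _≈_ B (f (0# A)) (0# B)
    pres-1 : _≈_ B (f (1# A)) (1# B)

Surjective : ∀ {a b ℓ ℓ'} {X : Set a} {Y : Set b} → Rel X ℓ → Rel Y ℓ' → (X → Y) → Set (a ⊔ b ⊔ ℓ')
Surjective {X = X} {Y} _≈X_ _≈Y_ f = ∀ (y : Y) → Σ X (λ x → f x ≈Y y)

Injective : ∀ {a b ℓ ℓ'} {X : Set a} {Y : Set b} → Rel X ℓ → Rel Y ℓ' → (X → Y) → Set (a ⊔ ℓ ⊔ ℓ')
Injective _≈X_ _≈Y_ f = ∀ {x y} → f x ≈Y f y → x ≈X y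

module _ {i c ℓ₁ ℓ₂ : Level} {I : Set i} (A : I → ResiduatedLattice c ℓ₁ ℓ₂) where

  private
    C = ∀ j → Carrier (A j)
    _≈'_ : Rel C (i ⊔ ℓ₁)
    x ≈' y = ∀ j → _≈_ (A j) (x j) (y j)
    _≤'_ : Rel C (i ⊔ ℓ₂)
    x ≤' y = ∀ j → _≤_ (A j) (x j) (y j)

    module BL j = IsBoundedLattice (isBoundedLattice (A j))
    module CM j = IsCommutativeMonoid (⊙-isCommutativeMonoid (A j))

    isEq : IsEquivalence _≈'_
    isEq = record
      { refl  = λ j → IsEquivalence.refl (BL.isEquivalence j)
      ; sym   = λ p j → IsEquivalence.sym (BL.isEquivalence j) (p j)
      ; trans = λ p q j → IsEquivalence.trans (BL.isEquivalence j) (p j) (q j)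
      }

    isPO : IsPartialOrder _≈'_ _≤'_
    isPO = record
      { isPreorder = record
        { isEquivalence = isEq
        ; reflexive = λ p j → BL.reflexive j (p j)
        ; trans = λ p q j → BL.trans j (p j) (q j)
        }
      ; antisym = λ p q j → BL.antisym j (p j) (q j)
      }

    isCM : IsCommutativeMonoid _≈'_ (λ x y j → _⊙_ (A j) (x j) (y j)) (λ j → 1# (A j))
    isCM = record
      { isMonoid = record
        { isSemigroup = record
          { isMagma = record
            { isEquivalence = isEq
            ; ∙-cong = λ p q j → CM.∙-cong j (p j) (q j)
            }
          ; assoc = λ x y z j → CM.assoc j (x j) (y j) (z j)
          }
        ; identity = (λ x j → proj₁ (CM.identity j) (x j))
                   , (λ x j → proj₂ (CM.identity j) (x j))
        }
      ; comm = λ x y j → CM.comm j (x j) (y j)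
      }

  Π-RL : ResiduatedLattice (i ⊔ c) (i ⊔ ℓ₁) (i ⊔ ℓ₂)
  Π-RL = record
    { Carrier = C
    ; _≈_ = _≈'_
    ; _≤_ = _≤'_
    ; _∨_ = λ x y j → _∨_ (A j) (x j) (y j)
    ; _∧_ = λ x y j → _∧_ (A j) (x j) (y j)
    ; _⊙_ = λ x y j → _⊙_ (A j) (x j) (y j)
    ; _⇒_ = λ x y j → _⇒_ (A j) (x j) (y j)
    ; 0# = λ j → 0# (A j)
    ; 1# = λ j → 1# (A j)
    ; isBoundedLattice = record
      { isLattice = record
        { isPartialOrder = isPO
        ; supremum = λ x y → (λ j → BL.x≤x∨y j (x j) (y j))
                           , (λ j → BL.y≤x∨y j (x j) (y j))
                           , (λ z p q j → BL.∨-least j (p j) (q j))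
        ; infimum = λ x y → (λ j → BL.x∧y≤x j (x j) (y j))
                          , (λ j → BL.x∧y≤y j (x j) (y j))
                          , (λ z p q j → BL.∧-greatest j (p j) (q j))
        }
      ; maximum = λ x j → BL.maximum j (x j)
      ; minimum = λ x j → BL.minimum j (x j)
      }
    ; ⊙-isCommutativeMonoid = isCM
    ; residuated = λ a b d → mk⇔
        (λ p j → Equivalence.to (residuated (A j) (a j) (b j) (d j)) (p j))
        (λ p j → Equivalence.from (residuated (A j) (a j) (b j) (d j)) (p j))
    }

-- Ds(A) and the congruence ∼Ds are given by equations between terms in
-- ⇒, ∧, 0, so morphisms commute with them. Hence an injective f reflects
-- x ∼Ds y from f x ∼Ds f y, and surjectivity passes to the quotient since
-- ≈ is contained in ∼Ds. In a product these terms are computed pointwise,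
-- so Ds and ∼Ds of the product are, by definition, the pointwise ones.
module Submission where

open import Defs
open import Level using (Level)
open import Data.Product using (_×_; _,_; proj₁; proj₂)
open import Function.Bundles using (_⇔_; Equivalence)
open import Function.Properties.Equivalence using () renaming (refl to ⇔-refl)
open import Relation.Binary.Lattice.Bundles using (BoundedLattice)
open import Algebra.Structures using (IsCommutativeMonoid)
import Relation.Binary.Lattice.Properties.MeetSemilattice as MeetSemilatticeProperties
import Relation.Binary.Reasoning.PartialOrder as PartialOrderReasoning
import Relation.Binary.Reasoning.Setoid as SetoidReasoning

module ResiduatedLatticeProperties {c ℓ₁ ℓ₂} (R : ResiduatedLattice c ℓ₁ ℓ₂) where
  open ResiduatedLattice R

  boundedLattice : BoundedLattice c ℓ₁ ℓ₂
  boundedLattice = record { isBoundedLattice = isBoundedLattice }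

  open BoundedLattice boundedLattice
    using (module Eq; reflexive; antisym; maximum; minimum; meetSemilattice; poset)
  open IsCommutativeMonoid ⊙-isCommutativeMonoid using (∙-congˡ; identityˡ; identityʳ)
  open MeetSemilatticeProperties meetSemilattice public using (∧-cong; y≤x⇒x∧y≈y)
  open PartialOrderReasoning poset

  curry : ∀ {a b d} → a ⊙ b ≤ d → a ≤ b ⇒ d
  curry = Equivalence.from (residuated _ _ _)

  uncurry : ∀ {a b d} → a ≤ b ⇒ d → a ⊙ b ≤ d
  uncurry = Equivalence.to (residuated _ _ _)

  modus-ponens : ∀ {b d} → (b ⇒ d) ⊙ b ≤ d
  modus-ponens = uncurry (reflexive Eq.refl)

  ⇒-monotonic-≈ : ∀ {b b′ d d′} → b ≈ b′ → d ≈ d′ → b ⇒ d ≤ b′ ⇒ d′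
  ⇒-monotonic-≈ {b} {b′} {d} {d′} b≈b′ d≈d′ = curry (begin
    (b ⇒ d) ⊙ b′ ≈⟨ ∙-congˡ (Eq.sym b≈b′) ⟩
    (b ⇒ d) ⊙ b  ≤⟨ modus-ponens ⟩
    d            ≈⟨ d≈d′ ⟩
    d′           ∎)

  ⇒-cong : ∀ {b b′ d d′} → b ≈ b′ → d ≈ d′ → b ⇒ d ≈ b′ ⇒ d′
  ⇒-cong b≈b′ d≈d′ =
    antisym (⇒-monotonic-≈ b≈b′ d≈d′) (⇒-monotonic-≈ (Eq.sym b≈b′) (Eq.sym d≈d′))

  ¬-cong : ∀ {a b} → a ≈ b → ¬ a ≈ ¬ b
  ¬-cong a≈b = ⇒-cong a≈b Eq.refl

  ⇒-reflexive : ∀ {a b} → a ≈ b → a ⇒ b ≈ 1#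
  ⇒-reflexive {a} {b} a≈b = antisym (maximum _) (curry (begin
    1# ⊙ a ≈⟨ identityˡ a ⟩
    a      ≈⟨ a≈b ⟩
    b      ∎))

  ¬1≈0 : ¬ 1# ≈ 0#
  ¬1≈0 = antisym (begin
    ¬ 1#      ≈⟨ identityʳ (¬ 1#) ⟨
    ¬ 1# ⊙ 1# ≤⟨ modus-ponens ⟩
    0#        ∎) (minimum _)

  ∼Ds-reflexive : ∀ {a b} → a ≈ b → a ∼Ds b
  ∼Ds-reflexive {a} {b} a≈b = Eq.trans (¬-cong biresiduum≈1) ¬1≈0
    where
    biresiduum≈1 : (a ⇒ b) ∧ (b ⇒ a) ≈ 1#
    biresiduum≈1 = Eq.trans (∧-cong (⇒-reflexive a≈b) (⇒-reflexive (Eq.sym a≈b)))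
                            (y≤x⇒x∧y≈y (maximum 1#))

module MorphismProperties
  {c₁ ℓ₁ ℓ₂ c₂ ℓ₃ ℓ₄} {A : ResiduatedLattice c₁ ℓ₁ ℓ₂} {B : ResiduatedLattice c₂ ℓ₃ ℓ₄}
  {f : ResiduatedLattice.Carrier A → ResiduatedLattice.Carrier B} (isMorphism : IsMorphism A B f)
  where
  private
    module A = ResiduatedLattice A
    module B = ResiduatedLattice B
  open IsMorphism isMorphism
  open ResiduatedLatticeProperties B using (⇒-cong; ¬-cong; ∧-cong; ∼Ds-reflexive)
  open BoundedLattice (ResiduatedLatticeProperties.boundedLattice B) using (module Eq; setoid)
  open SetoidReasoning setoid

  pres-¬ : ∀ x → f (A.¬ x) B.≈ B.¬ f x
  pres-¬ x = Eq.trans (pres-⇒ x A.0#) (⇒-cong Eq.refl pres-0)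

  pres-biresiduum : ∀ x y → f ((x A.⇒ y) A.∧ (y A.⇒ x)) B.≈ (f x B.⇒ f y) B.∧ (f y B.⇒ f x)
  pres-biresiduum x y = Eq.trans (pres-∧ _ _) (∧-cong (pres-⇒ x y) (pres-⇒ y x))

  surjective⇒surjective-mod-Ds : Surjective A._≈_ B._≈_ f → Surjective A._∼Ds_ B._∼Ds_ f
  surjective⇒surjective-mod-Ds surj y = proj₁ (surj y) , ∼Ds-reflexive (proj₂ (surj y))

  injective⇒injective-mod-Ds : Injective A._≈_ B._≈_ f → Injective A._∼Ds_ B._∼Ds_ f
  injective⇒injective-mod-Ds inj {x} {y} fx∼fy = inj (begin
    f (A.¬ ((x A.⇒ y) A.∧ (y A.⇒ x)))     ≈⟨ pres-¬ _ ⟩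
    B.¬ f ((x A.⇒ y) A.∧ (y A.⇒ x))       ≈⟨ ¬-cong (pres-biresiduum x y) ⟩
    B.¬ ((f x B.⇒ f y) B.∧ (f y B.⇒ f x)) ≈⟨ fx∼fy ⟩
    B.0#                                  ≈⟨ pres-0 ⟨
    f A.0#                                ∎)

module _ {i c ℓ₁ ℓ₂} {I : Set i} (A : I → ResiduatedLattice c ℓ₁ ℓ₂) where
  private
    module Π = ResiduatedLattice (Π-RL A)
    module A j = ResiduatedLattice (A j)

  Ds-Π : ∀ a → Π.Ds a ⇔ (∀ j → A.Ds j (a j))
  Ds-Π a = ⇔-refl

  ∼Ds-Π : ∀ a b → a Π.∼Ds b ⇔ (∀ j → A._∼Ds_ j (a j) (b j))
  ∼Ds-Π a b = ⇔-refl

proposition4p4 :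
    ∀ {c₁ ℓ₁ ℓ₂ c₂ ℓ₃ ℓ₄ i c ℓ₅ ℓ₆ : Level} →
    (∀ (A : ResiduatedLattice c₁ ℓ₁ ℓ₂) (B : ResiduatedLattice c₂ ℓ₃ ℓ₄)
       (f : ResiduatedLattice.Carrier A → ResiduatedLattice.Carrier B) → IsMorphism A B f →
       (Surjective (ResiduatedLattice._≈_ A) (ResiduatedLattice._≈_ B) f →
          Surjective (ResiduatedLattice._∼Ds_ A) (ResiduatedLattice._∼Ds_ B) f)
       × (Injective (ResiduatedLattice._≈_ A) (ResiduatedLattice._≈_ B) f →
          Injective (ResiduatedLattice._∼Ds_ A) (ResiduatedLattice._∼Ds_ B) f))
    ×
    (∀ {I : Set i} (A : I → ResiduatedLattice c ℓ₅ ℓ₆) →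
       (∀ a → ResiduatedLattice.Ds (Π-RL A) a ⇔ (∀ j → ResiduatedLattice.Ds (A j) (a j)))
       × (∀ a b → ResiduatedLattice._∼Ds_ (Π-RL A) a b
                  ⇔ (∀ j → ResiduatedLattice._∼Ds_ (A j) (a j) (b j))))
proposition4p4 =
  (λ A B f isMorphism → let open MorphismProperties isMorphism in
     surjective⇒surjective-mod-Ds , injective⇒injective-mod-Ds)
  , λ A → Ds-Π A , ∼Ds-Π A
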